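{- Let $n\ge 2$ and let $f$ be a nested canalyzing function in $n$ variables with layer number $r$. If $r=1$ then $s(f)=n$. If $r=n-1$ then $s(f)=\frac{n+2}{2}$ when $n$ is even and $s(f)=\frac{n+1}{2}$ when $n$ is odd. If $2\le r\le n-2$ then $$\frac{n+1}{2}\le s(f)\le\begin{cases} n+1-\frac{r+1}{2}, & r\text{ odd},\\ n+1-\frac{r}{2}, & r\text{ even}.\end{cases}$$
   Context: Work over $\mathbb{F}_2$, $\oplus$ is addition mod 2 and $\overline{a}=a\oplus 1$. A Boolean function $f:\mathbb{F}_2^n\to\mathbb{F}_2$ is nested canalyzing (NCF) in the variable order $x_{\sigma(1)},\dots,x_{\sigma(n)}$ ($\sigma$ a permutation of $\{1,\dots,n\}$) with canalyzing inputs $a_1,\dots,a_n$ and canalyzed values $b_1,\dots,b_n$ if $f=b_1$ when $x_{\sigma(1)}=a_1$; $f=b_k$ when $x_{\sigma(j)}=\overline{a_j}$ for $j<k$ and $x_{\sigma(k)}=a_k$ ($k=2,\dots,n$); and $f=\overline{b_n}$ when $x_{\sigma(j)}=\overline{a_j}$ for all $j$. $f$ is an NCF if this holds for some $\sigma$. It is known that for $n\ge2$ every NCF can be written uniquely as $f=M_1(M_2(\cdots(M_{r-1}(M_r\oplus1)\oplus1)\cdots)\oplus1)\oplus b$, where $M_i=\prod_{j=1}^{k_i}(x_{i_j}\oplus a_{i_j})$, $k_i\ge1$ for $i<r$, $k_r\ge2$, $k_1+\dots+k_r=n$, $a_{i_j},b\in\mathbb{F}_2$, and the variables $x_{i_j}$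 are exactly $x_1,\dots,x_n$, each once. The number $r$ is the layer number of $f$. The sensitivity of $f$ at $\mathbf{x}$, $s(f;\mathbf{x})$, is the number of $i$ such that flipping the $i$-th bit of $\mathbf{x}$ changes the value of $f$; $s(f)=\max_{\mathbf{x}}s(f;\mathbf{x})$. -}

module Defs where

open import Data.Bool using (Bool; true; false; not; _∧_; _xor_)
open import Data.Nat using (ℕ; zero; suc; _≤_; _<_; _∸_; _⊔_)
open import Data.Fin using (Fin; toℕ)
open import Data.Fin.Permutation using (Permutation′; _⟨$⟩ʳ_)
open import Data.List using (List; []; _∷_; map; foldr; length; concat; _++_; allFin; [_])
open import Data.List.Relation.Unary.All using (All)
open import Data.List.Relation.Binary.Permutation.Propositional using (_↭_)
open import Data.Product using (_×_; proj₁; proj₂; _,_)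
open import Relation.Binary.PropositionalEquality using (_≡_; _≢_)
open import Relation.Nullary.Decidable using (⌊_⌋)
open import Data.Bool.Properties using () renaming (_≟_ to _≟ᵇ_)
open import Data.Fin using (_≟_)

-- Inputs in F_2^n, Boolean functions F_2^n → F_2 (F_2 = Bool, ⊕ = xor)
Input : ℕ → Set
Input n = Fin n → Bool

BoolFun : ℕ → Set
BoolFun n = Input n → Bool

-- Nested canalyzing function in variable order σ with canalyzing inputs a
-- and canalyzed values b (σ(k) is the k-th variable in the order).
IsNCFWith : (n : ℕ) → BoolFun n → Permutation′ n → (Fin n → Bool) → (Fin n → Bool) → Set
IsNCFWith n f σ a b =
  (∀ (k : Fin n) (x : Input n) →
     (∀ (j : Fin n) → toℕ j < toℕ k → x (σ ⟨$⟩ʳ j) ≡ not (a j)) →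
     x (σ ⟨$⟩ʳ k) ≡ a k → f x ≡ b k)
  ×
  (∀ (x : Input n) →
     (∀ (j : Fin n) → x (σ ⟨$⟩ʳ j) ≡ not (a j)) →
     ∀ (k : Fin n) → toℕ k ≡ n ∸ 1 → f x ≡ not (b k))

data IsNCF (n : ℕ) (f : BoolFun n) : Set where
  isNCF : (σ : Permutation′ n) (a b : Fin n → Bool) → IsNCFWith n f σ a b → IsNCF n f

-- A layer M_i = ∏_j (x_{i_j} ⊕ a_{i_j}) is given by the list of pairs (i_j , a_{i_j}).
Layer : ℕ → Set
Layer n = List (Fin n × Bool)

evalLayer : ∀ {n} → Layer n → Input n → Bool
evalLayer L x = foldr (λ p acc → (x (proj₁ p) xor proj₂ p) ∧ acc) true L

-- nest [M_1,...,M_{r-1}] M_r x = M_1(M_2(⋯(M_{r-1}(M_r ⊕ 1) ⊕ 1)⋯) ⊕ 1)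
-- (and = M_r when r = 1)
nest : ∀ {n} → List (Layer n) → Layer n → Input n → Bool
nest [] Mr x = evalLayer Mr x
nest (M ∷ Ms) Mr x = evalLayer M x ∧ (nest Ms Mr x xor true)

record HasLayerNumber (n : ℕ) (f : BoolFun n) (r : ℕ) : Set where
  field
    Ms       : List (Layer n)
    Mr       : Layer n
    b        : Bool
    nLayers  : suc (length Ms) ≡ r
    kPos     : All (λ M → 1 ≤ length M) Ms
    krGe2    : 2 ≤ length Mr
    vars     : map proj₁ (concat (Ms ++ [ Mr ])) ↭ allFin n
    repr     : ∀ (x : Input n) → f x ≡ (nest Ms Mr x xor b)

flipAt : ∀ {n} → Fin n → Input n → Input n
flipAt i x j with ⌊ i ≟ j ⌋
... | true  = not (x j)
... | false = x j

sensAt : ∀ {n} → BoolFun n → Input n → ℕ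
sensAt {n} f x =
  length (Data.List.filter (λ i → Relation.Nullary.¬? (f (flipAt i x) ≟ᵇ f x)) (allFin n))
  where import Data.List ; import Relation.Nullary

allInputs : (n : ℕ) → List (Input n)
allInputs zero = (λ ()) ∷ []
allInputs (suc n) =
  concat (map (λ x → (λ { Fin.zero → false ; (Fin.suc j) → x j }) ∷
                      (λ { Fin.zero → true  ; (Fin.suc j) → x j }) ∷ []) (allInputs n))
  where import Data.Fin as Fin

sensitivity : ∀ {n} → BoolFun n → ℕ
sensitivity {n} f = foldr (λ x m → sensAt f x ⊔ m) 0 (allInputs n)

module Submission where

-- Only the layered representation f = g ⊕ b, g = M₁ ∧ ¬(M₂ ∧ ¬(⋯ ∧ ¬Mᵣ)), is used:
-- the layers Mᵢ are products of literals over disjoint variables covering all n.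
-- We compute s(f) exactly. For layer sizes k₁, …, kᵣ define two "peaks"
--   peak true  [] k = k          peak true  (m ∷ ks) k = m + peak false ks k
--   peak false [] k = 1          peak false (m ∷ ks) k = peak true ks k
-- (ks = k₁ … k_{r-1}, k = kᵣ). The most sensitive input where g = c has exactly
-- peak c sensitive variables. Upper bound, by induction on the layers: a satisfied
-- layer has all its variables sensitive, a falsified one at most one, and in u ∧ ¬g
-- (u, g on disjoint variables) the variables of u count only when g = 0, those of g
-- only when u = 1. Lower bound: satisfy the outer layer on top of a witness for the
-- inner nest. Hence s(f) = peak false ⊔ peak true.

open import Defs
open import Data.Nat using (ℕ; _+_; _*_; _≤_)
open import Data.Nat.Divisibility using (_∣_)
open import Relation.Nullary using (¬_)
open import Relation.Binary.PropositionalEquality using (_≡_)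
open import Data.Product using (_×_)

open import Data.Bool using (Bool; true; false; not; _∧_; _xor_)
open import Data.Bool.Properties
  using (∧-zeroʳ; ∧-identityʳ; ∧-conicalˡ; ∧-conicalʳ; xor-assoc; xor-same; xor-identityʳ;
         xor-inverseˡ; not-distribˡ-xor; not-involutive)
  renaming (_≟_ to _≟ᵇ_)
open import Data.Nat using (suc; _⊔_; z≤n; s≤s; _<_)
open import Data.Nat.Properties
  using (≤-refl; ≤-reflexive; ≤-trans; ≤-antisym; <⇒≤; ≤-pred; ≤∧≢⇒<; n≤1+n; m≤m+n; m≤n+m;
         +-comm; +-assoc; +-identityʳ; +-suc; +-monoʳ-≤; +-mono-≤; +-cancelʳ-≤; *-suc; *-monoʳ-≤;
         *-cancelˡ-≤; *-distribˡ-+; m≤m⊔n; m≤n⊔m; ⊔-lub; m≤n⇒m⊔n≡n; *-distribˡ-⊔; +-distribʳ-⊔;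
         module ≤-Reasoning)
open import Data.Nat.Divisibility using (∣m+n∣m⇒∣n; ∣1⇒≡1; m∣m*n; ∣-refl)
open import Data.Nat.Tactic.RingSolver using (solve-∀)
open import Data.Nat.ListAction using (sum)
open import Data.Fin using (Fin; _≟_)
import Data.Fin as Fin
open import Data.List using (List; []; _∷_; map; length; _++_; concat; allFin; [_]; filter; foldr)
open import Data.List.Properties
  using (length-map; length-++; map-++; ++-identityʳ; length-tabulate;
         filter-all; filter-none; filter-some; filter-reject; filter-++; filter-≐)
open import Data.List.Membership.Propositional using (_∈_; _∉_)
open import Data.List.Membership.Propositional.Properties using (∈-++⁺ˡ; ∈-++⁺ʳ; ∈-map⁺; ∈-concat⁺′)
open import Data.List.Relation.Unary.Any using (here; there)
open import Data.List.Relation.Unary.All as All using (All; _∷_)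
import Data.List.Relation.Unary.All.Properties as All
open import Data.List.Relation.Unary.AllPairs using ([]; _∷_)
open import Data.List.Relation.Unary.Unique.Propositional using (Unique)
open import Data.List.Relation.Unary.Unique.Propositional.Properties using (allFin⁺)
open import Data.List.Relation.Binary.Permutation.Propositional using (_↭_; ↭-sym; ↭⇒↭ₛ)
open import Data.List.Relation.Binary.Permutation.Propositional.Properties using (↭-length; filter-↭)
open import Data.List.Relation.Binary.Permutation.Setoid.Properties using (Unique-resp-↭)
open import Data.Vec.Functional using (updateAt)
open import Data.Vec.Functional.Properties using (updateAt-updates; updateAt-minimal)
open import Data.Product using (_,_; proj₁; proj₂; ∃-syntax)
open import Function using (const)
open import Level using (0ℓ)
open import Relation.Nullary using (yes; no; ¬?; contradiction)
open import Relation.Unary using (Pred; Decidable)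
open import Relation.Binary.PropositionalEquality
  using (_≢_; refl; sym; trans; cong; cong₂; subst; subst₂; setoid; module ≡-Reasoning)

module _ {A : Set} {P Q : Pred A 0ℓ} (P? : Decidable P) (Q? : Decidable Q) where

  length-filter-cong : ∀ xs → (∀ {v} → v ∈ xs → P v → Q v) → (∀ {v} → v ∈ xs → Q v → P v) →
                       length (filter P? xs) ≡ length (filter Q? xs)
  length-filter-cong [] _ _ = refl
  length-filter-cong (v ∷ xs) to from with P? v | Q? v
  ... | yes _  | yes _  = cong suc (length-filter-cong xs (λ w∈ → to (there w∈)) (λ w∈ → from (there w∈)))
  ... | no _   | no _   = length-filter-cong xs (λ w∈ → to (there w∈)) (λ w∈ → from (there w∈))
  ... | yes Pv | no ¬Qv = contradiction (to (here refl) Pv) ¬Qv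
  ... | no ¬Pv | yes Qv = contradiction (from (here refl) Qv) ¬Pv

length-filter-∷ : ∀ {A : Set} {P : Pred A 0ℓ} (P? : Decidable P) v xs →
                  length (filter P? (v ∷ xs)) ≤ suc (length (filter P? xs))
length-filter-∷ P? v xs with P? v
... | yes _ = ≤-refl
... | no _  = n≤1+n _

unique-++⁻ : ∀ {A : Set} (xs : List A) {ys} → Unique (xs ++ ys) →
             Unique xs × Unique ys × (∀ {v} → v ∈ xs → v ∉ ys)
unique-++⁻ [] u = [] , u , λ ()
unique-++⁻ (x ∷ xs) (x∉ ∷ u) with unique-++⁻ xs u
... | uxs , uys , disjoint = All.++⁻ˡ xs x∉ ∷ uxs , uys , apart
  where
    apart : ∀ {v} → v ∈ x ∷ xs → v ∉ _
    apart (here refl) v∈ys = All.lookup (All.++⁻ʳ xs x∉) v∈ys refl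
    apart (there v∈xs)     = disjoint v∈xs

xor-injectiveʳ : ∀ c {a b} → a xor c ≡ b xor c → a ≡ b
xor-injectiveʳ c {a} {b} e = trans (sym (cancel a)) (trans (cong (_xor c) e) (cancel b))
  where
    cancel : ∀ v → (v xor c) xor c ≡ v
    cancel v = trans (xor-assoc v c c) (trans (cong (v xor_) (xor-same c)) (xor-identityʳ v))

module _ {A : Set} (F : A → ℕ) where

  maxOf : List A → ℕ
  maxOf = foldr (λ x acc → F x ⊔ acc) 0

  maxOf-lub : ∀ xs {m} → (∀ {x} → x ∈ xs → F x ≤ m) → maxOf xs ≤ m
  maxOf-lub []       _     = z≤n
  maxOf-lub (x ∷ xs) bound = ⊔-lub (bound (here refl)) (maxOf-lub xs (λ x∈ → bound (there x∈)))

  maxOf-upper : ∀ {xs y} → y ∈ xs → F y ≤ maxOf xs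
  maxOf-upper {x ∷ _}  (here refl) = m≤m⊔n (F x) _
  maxOf-upper {x ∷ xs} (there y∈)  = ≤-trans (maxOf-upper y∈) (m≤n⊔m (F x) _)

allInputs-complete : ∀ n (x : Input n) → ∃[ y ] y ∈ allInputs n × (∀ i → y i ≡ x i)
allInputs-complete 0       x = _ , here refl , λ ()
allInputs-complete (suc n) x with allInputs-complete n (λ i → x (Fin.suc i)) | x Fin.zero in x₀
... | y , y∈ , y≗ | false =
  _ , ∈-concat⁺′ (here refl) (∈-map⁺ _ y∈) , λ { Fin.zero → sym x₀ ; (Fin.suc i) → y≗ i }
... | y , y∈ , y≗ | true  =
  _ , ∈-concat⁺′ (there (here refl)) (∈-map⁺ _ y∈) , λ { Fin.zero → sym x₀ ; (Fin.suc i) → y≗ i }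

module _ {n : ℕ} where

  Agree : List (Fin n) → Input n → Input n → Set
  Agree V x y = ∀ {i} → i ∈ V → x i ≡ y i

  DependsOn : BoolFun n → List (Fin n) → Set
  DependsOn h V = ∀ {x y} → Agree V x y → h x ≡ h y

  flipAt-self : ∀ i (x : Input n) → flipAt i x i ≡ not (x i)
  flipAt-self i x with i ≟ i
  ... | yes _   = refl
  ... | no i≢i  = contradiction refl i≢i

  flipAt-other : ∀ {i j} (x : Input n) → i ≢ j → flipAt i x j ≡ x j
  flipAt-other {i} {j} x i≢j with i ≟ j
  ... | yes i≡j = contradiction i≡j i≢j
  ... | no _    = refl

  flipAt-involutive : ∀ i (x : Input n) j → flipAt i (flipAt i x) j ≡ x j
  flipAt-involutive i x j with i ≟ j
  ... | yes refl = trans (cong not (flipAt-self i x)) (not-involutive (x i))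
  ... | no i≢j  = flipAt-other x i≢j

  flipAt-agree : ∀ {V x y} i → Agree V x y → Agree V (flipAt i x) (flipAt i y)
  flipAt-agree i x≈y {j} j∈V with i ≟ j
  ... | yes _ = cong not (x≈y j∈V)
  ... | no _  = x≈y j∈V

  flipAt-outside : ∀ {V i} (x : Input n) → i ∉ V → Agree V (flipAt i x) x
  flipAt-outside {i = i} x i∉V j∈V = flipAt-other {i} x (λ { refl → i∉V j∈V })

  Sensitive : BoolFun n → Input n → Pred (Fin n) 0ℓ
  Sensitive h x i = h (flipAt i x) ≢ h x

  sensitive? : ∀ h x → Decidable (Sensitive h x)
  sensitive? h x i = ¬? (h (flipAt i x) ≟ᵇ h x)

  -- The number of sensitive variables of h at x among V; sensAt h x is sensOn h (allFin n) x.
  sensOn : BoolFun n → List (Fin n) → Input n → ℕ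
  sensOn h V x = length (filter (sensitive? h x) V)

  sensOn-++ : ∀ h V W x → sensOn h (V ++ W) x ≡ sensOn h V x + sensOn h W x
  sensOn-++ h V W x = trans (cong length (filter-++ (sensitive? h x) V W)) (length-++ (filter (sensitive? h x) V))

  sensOn-↭ : ∀ h {V W} x → V ↭ W → sensOn h V x ≡ sensOn h W x
  sensOn-↭ h x V↭W = ↭-length (filter-↭ (sensitive? h x) V↭W)

  sensOn-cong : ∀ {h u : BoolFun n} {x} V → (∀ {i} → i ∈ V → h (flipAt i x) ≡ u (flipAt i x)) →
                h x ≡ u x → sensOn h V x ≡ sensOn u V x
  sensOn-cong {h} {u} {x} V flips at-x =
    length-filter-cong (sensitive? h x) (sensitive? u x) V
      (λ i∈V → subst₂ _≢_ (flips i∈V) at-x) (λ i∈V → subst₂ _≢_ (sym (flips i∈V)) (sym at-x))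

  sensOn-none : ∀ {h : BoolFun n} {x} V → (∀ {i} → i ∈ V → h (flipAt i x) ≡ h x) → sensOn h V x ≡ 0
  sensOn-none {h} {x} V stable = cong length (filter-none (sensitive? h x) (All.tabulate (λ i∈V s → s (stable i∈V))))

  sensOn-xor : ∀ (h : BoolFun n) c V x → sensOn (λ y → h y xor c) V x ≡ sensOn h V x
  sensOn-xor h c V x =
    cong length (filter-≐ (sensitive? (λ y → h y xor c) x) (sensitive? h x)
      ((λ s e → s (cong (_xor c) e)) , (λ s e → s (xor-injectiveʳ c e))) V)

  sensOn-agree : ∀ {h W x y} V → DependsOn h W → Agree W x y → sensOn h V x ≡ sensOn h V y
  sensOn-agree {h} {x = x} {y} V dep x≈y =
    cong length (filter-≐ (sensitive? h x) (sensitive? h y)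
      ((λ {i} → subst₂ _≢_ (dep (flipAt-agree i x≈y)) (dep x≈y)) ,
       (λ {i} → subst₂ _≢_ (sym (dep (flipAt-agree i x≈y))) (sym (dep x≈y)))) V)

module _ {n : ℕ} where

  vars : Layer n → List (Fin n)
  vars = map proj₁

  layer-depends : ∀ M → DependsOn (evalLayer {n} M) (vars M)
  layer-depends []            _   = refl
  layer-depends ((j , a) ∷ M) x≈y =
    cong₂ (λ u v → (u xor a) ∧ v) (x≈y (here refl)) (layer-depends M (λ i∈M → x≈y (there i∈M)))

  literal-flip : ∀ j a (x : Input n) → flipAt j x j xor a ≡ not (x j xor a)
  literal-flip j a x = trans (cong (_xor a) (flipAt-self j x)) (sym (not-distribˡ-xor (x j) a))

  layer-flip : ∀ M {x : Input n} {i} → evalLayer M x ≡ true → i ∈ vars M → evalLayer M (flipAt i x) ≡ false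
  layer-flip ((j , a) ∷ M) {x} Mx (here refl) =
    cong (_∧ evalLayer M (flipAt j x)) (trans (literal-flip j a x) (cong not (∧-conicalˡ _ _ Mx)))
  layer-flip ((j , a) ∷ M) {x} {i} Mx (there i∈M) =
    trans (cong ((flipAt i x j xor a) ∧_) (layer-flip M (∧-conicalʳ _ _ Mx) i∈M)) (∧-zeroʳ _)

  layer-sens-true : ∀ M {x : Input n} → evalLayer M x ≡ true → sensOn (evalLayer M) (vars M) x ≡ length M
  layer-sens-true M {x} Mx =
    trans (cong length (filter-all (sensitive? (evalLayer M) x) (All.tabulate all-sensitive))) (length-map proj₁ M)
    where
      all-sensitive : ∀ {i} → i ∈ vars M → Sensitive (evalLayer M) x i
      all-sensitive i∈M e with () ← trans (sym (layer-flip M Mx i∈M)) (trans e Mx)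

  -- In a falsified layer at most one variable is sensitive: a false literal, if it is the only one.
  layer-sens-false : ∀ M {x : Input n} → Unique (vars M) → evalLayer M x ≡ false →
                     sensOn (evalLayer M) (vars M) x ≤ 1
  layer-sens-false ((j , a) ∷ M) {x} (j∉M ∷ uM) Mx = by-literal (x j xor a) refl
    where
      h = evalLayer ((j , a) ∷ M)

      literal-stable : ∀ {i} → i ∈ vars M → flipAt i x j xor a ≡ x j xor a
      literal-stable i∈M = cong (_xor a) (flipAt-other x (λ i≡j → All.lookup j∉M i∈M (sym i≡j)))

      by-literal : ∀ ℓ → x j xor a ≡ ℓ → sensOn h (j ∷ vars M) x ≤ 1
      -- a false literal keeps the layer false under every other flip
      by-literal false lit = ≤-trans (length-filter-∷ (sensitive? h x) j (vars M))
        (s≤s (≤-reflexive (sensOn-none {h = h} (vars M) (λ {i} i∈M →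
          trans (cong (_∧ evalLayer M (flipAt i x)) (trans (literal-stable i∈M) lit)) (sym Mx)))))
      -- a true literal: x_j is insensitive and the other variables behave as in M
      by-literal true lit = begin
        sensOn h (j ∷ vars M) x            ≡⟨ cong length (filter-reject (sensitive? h x) {j} {vars M} (λ s → s j-stable)) ⟩
        sensOn h (vars M) x                ≡⟨ sensOn-cong {h = h} {u = evalLayer M} (vars M)
                                                (λ {i} i∈M → cong (_∧ evalLayer M (flipAt i x)) (trans (literal-stable i∈M) lit))
                                                (cong (_∧ evalLayer M x) lit) ⟩
        sensOn (evalLayer M) (vars M) x    ≤⟨ layer-sens-false M uM (trans (cong (_∧ evalLayer M x) (sym lit)) Mx) ⟩
        1 ∎
        where
          open ≤-Reasoning
          j-stable : h (flipAt j x) ≡ h x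
          j-stable = trans (cong (_∧ evalLayer M (flipAt j x)) (trans (literal-flip j a x) (cong not lit))) (sym Mx)

  satisfy : Layer n → Input n → Input n
  satisfy []            x = x
  satisfy ((j , a) ∷ M) x = updateAt (satisfy M x) j (const (not a))

  satisfy-outside : ∀ M (x : Input n) {i} → i ∉ vars M → satisfy M x i ≡ x i
  satisfy-outside []            x i∉M = refl
  satisfy-outside ((j , a) ∷ M) x {i} i∉M =
    trans (updateAt-minimal i j (satisfy M x) (λ i≡j → i∉M (here i≡j))) (satisfy-outside M x (λ i∈ → i∉M (there i∈)))

  satisfy-true : ∀ M (x : Input n) → Unique (vars M) → evalLayer M (satisfy M x) ≡ true
  satisfy-true []            x _          = refl
  satisfy-true ((j , a) ∷ M) x (j∉M ∷ uM) = cong₂ _∧_ literal rest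
    where
      y = satisfy M x
      literal : updateAt y j (const (not a)) j xor a ≡ true
      literal = trans (cong (_xor a) (updateAt-updates j y)) (xor-inverseˡ a)
      rest : evalLayer M (updateAt y j (const (not a))) ≡ true
      rest = trans (layer-depends M (λ {i} i∈M → updateAt-minimal i j y (λ i≡j → All.lookup j∉M i∈M (sym i≡j))))
                   (satisfy-true M x uM)

module _ {n : ℕ} where

  _∧¬_ : BoolFun n → BoolFun n → BoolFun n
  (u ∧¬ g) x = u x ∧ (g x xor true)

  ∧¬-g-true : ∀ {u g : BoolFun n} {x} → g x ≡ true → (u ∧¬ g) x ≡ false
  ∧¬-g-true {u} {x = x} gx = trans (cong (λ v → u x ∧ (v xor true)) gx) (∧-zeroʳ (u x))

  ∧¬-g-false : ∀ {u g : BoolFun n} {x} → g x ≡ false → (u ∧¬ g) x ≡ u x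
  ∧¬-g-false {u} {x = x} gx = trans (cong (λ v → u x ∧ (v xor true)) gx) (∧-identityʳ (u x))

  ∧¬-u-false : ∀ {u g : BoolFun n} {x} → u x ≡ false → (u ∧¬ g) x ≡ false
  ∧¬-u-false {g = g} {x} ux = cong (_∧ (g x xor true)) ux

  ∧¬-u-true : ∀ {u g : BoolFun n} {x} → u x ≡ true → (u ∧¬ g) x ≡ g x xor true
  ∧¬-u-true {g = g} {x} ux = cong (_∧ (g x xor true)) ux

  -- u reads V, g reads W, and V, W are disjoint: the variables of u are sensitive for
  -- u ∧ ¬g only while g x = 0, those of g only while u x = 1.
  module AndNot {u g : BoolFun n} {V W : List (Fin n)}
                (u-dep : DependsOn u V) (g-dep : DependsOn g W) (disjoint : ∀ {i} → i ∈ V → i ∉ W) where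

    g-fixed : ∀ x {i} → i ∈ V → g (flipAt i x) ≡ g x
    g-fixed x i∈V = g-dep (flipAt-outside x (disjoint i∈V))

    u-fixed : ∀ x {i} → i ∈ W → u (flipAt i x) ≡ u x
    u-fixed x i∈W = u-dep (flipAt-outside x (λ i∈V → disjoint i∈V i∈W))

    sens-V-blocked : ∀ {x} → g x ≡ true → sensOn (u ∧¬ g) V x ≡ 0
    sens-V-blocked {x} gx = sensOn-none {h = u ∧¬ g} V (λ i∈V →
      trans (∧¬-g-true {u} {g} (trans (g-fixed x i∈V) gx)) (sym (∧¬-g-true {u} {g} gx)))

    sens-V-free : ∀ {x} → g x ≡ false → sensOn (u ∧¬ g) V x ≡ sensOn u V x
    sens-V-free {x} gx = sensOn-cong {h = u ∧¬ g} {u = u} V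
      (λ i∈V → ∧¬-g-false {u} {g} (trans (g-fixed x i∈V) gx)) (∧¬-g-false {u} {g} gx)

    sens-W-blocked : ∀ {x} → u x ≡ false → sensOn (u ∧¬ g) W x ≡ 0
    sens-W-blocked {x} ux = sensOn-none {h = u ∧¬ g} W (λ i∈W →
      trans (∧¬-u-false {u} {g} (trans (u-fixed x i∈W) ux)) (sym (∧¬-u-false {u} {g} ux)))

    sens-W-free : ∀ {x} → u x ≡ true → sensOn (u ∧¬ g) W x ≡ sensOn g W x
    sens-W-free {x} ux =
      trans (sensOn-cong {h = u ∧¬ g} {u = λ y → g y xor true} W
               (λ i∈W → ∧¬-u-true {u} {g} (trans (u-fixed x i∈W) ux)) (∧¬-u-true {u} {g} ux))
            (sensOn-xor g true W x)

-- The peaks of a layer-size profile (sizes ks of the first layers, size k of the last):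
-- peak c ks k will be the largest sensitivity of the nested product at inputs where it equals c.
peak : Bool → List ℕ → ℕ → ℕ
peak true  []       k = k
peak false []       k = 1
peak true  (m ∷ ks) k = m + peak false ks k
peak false (m ∷ ks) k = peak true ks k

peak-pos : ∀ c ks {k} → 1 ≤ k → 1 ≤ peak c ks k
peak-pos true  []       k≥1 = k≥1
peak-pos false []       _   = ≤-refl
peak-pos true  (m ∷ ks) k≥1 = ≤-trans (peak-pos false ks k≥1) (m≤n+m _ m)
peak-pos false (m ∷ ks) k≥1 = peak-pos true ks k≥1

peak-≤-⊔ : ∀ c ks k → peak c ks k ≤ peak false ks k ⊔ peak true ks k
peak-≤-⊔ true  ks k = m≤n⊔m (peak false ks k) _
peak-≤-⊔ false ks k = m≤m⊔n _ (peak true ks k)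

peak-sum : ∀ ks k → peak false ks k + peak true ks k ≡ suc (sum ks + k)
peak-sum []       k = refl
peak-sum (m ∷ ks) k = begin
  peak true ks k + (m + peak false ks k)   ≡⟨ +-comm (peak true ks k) _ ⟩
  (m + peak false ks k) + peak true ks k   ≡⟨ +-assoc m _ _ ⟩
  m + (peak false ks k + peak true ks k)   ≡⟨ cong (m +_) (peak-sum ks k) ⟩
  m + suc (sum ks + k)                     ≡⟨ +-suc m _ ⟩
  suc (m + (sum ks + k))                   ≡⟨ cong suc (+-assoc m (sum ks) k) ⟨
  suc (m + sum ks + k)                     ∎
  where open ≡-Reasoning

peak-lower : ∀ ks {k} → All (1 ≤_) ks → 2 ≤ k →
             (2 + length ks ≤ 2 * peak false ks k) × (3 + length ks ≤ 2 * peak true ks k)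
peak-lower []       _          k≥2 = ≤-refl , ≤-trans (n≤1+n 3) (*-monoʳ-≤ 2 k≥2)
peak-lower (m ∷ ks) (m≥1 ∷ ks≥1) k≥2 with peak-lower ks ks≥1 k≥2
... | lo-false , lo-true = lo-true , (begin
  4 + length ks                   ≤⟨ +-mono-≤ (*-monoʳ-≤ 2 m≥1) lo-false ⟩
  2 * m + 2 * peak false ks _     ≡⟨ *-distribˡ-+ 2 m _ ⟨
  2 * (m + peak false ks _)       ∎)
  where open ≤-Reasoning

module _ {n : ℕ} where

  support : List (Layer n) → Layer n → List (Fin n)
  support []       Mr = vars Mr
  support (M ∷ Ms) Mr = vars M ++ support Ms Mr

  sizes : List (Layer n) → List ℕ
  sizes = map length

  support-concat : ∀ Ms Mr → support Ms Mr ≡ map proj₁ (concat (Ms ++ [ Mr ]))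
  support-concat []       Mr = cong vars (sym (++-identityʳ Mr))
  support-concat (M ∷ Ms) Mr =
    trans (cong (vars M ++_) (support-concat Ms Mr)) (sym (map-++ proj₁ M (concat (Ms ++ [ Mr ]))))

  length-support : ∀ Ms Mr → length (support Ms Mr) ≡ sum (sizes Ms) + length Mr
  length-support []       Mr = length-map proj₁ Mr
  length-support (M ∷ Ms) Mr = begin
    length (vars M ++ support Ms Mr)            ≡⟨ length-++ (vars M) ⟩
    length (vars M) + length (support Ms Mr)    ≡⟨ cong₂ _+_ (length-map proj₁ M) (length-support Ms Mr) ⟩
    length M + (sum (sizes Ms) + length Mr)     ≡⟨ +-assoc (length M) _ _ ⟨
    length M + sum (sizes Ms) + length Mr       ∎
    where open ≡-Reasoning

  nest-depends : ∀ Ms Mr → DependsOn (nest {n} Ms Mr) (support Ms Mr)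
  nest-depends []       Mr = layer-depends Mr
  nest-depends (M ∷ Ms) Mr x≈y =
    cong₂ (λ u v → u ∧ (v xor true)) (layer-depends M (λ i∈M → x≈y (∈-++⁺ˡ i∈M)))
          (nest-depends Ms Mr (λ i∈ → x≈y (∈-++⁺ʳ (vars M) i∈)))

  sens-upper : ∀ Ms Mr → Unique (support Ms Mr) → 1 ≤ length Mr → ∀ x →
               sensOn (nest Ms Mr) (support Ms Mr) x ≤ peak (nest Ms Mr x) (sizes Ms) (length Mr)
  sens-upper [] Mr u _ x = by-value (evalLayer Mr x) refl
    where
      by-value : ∀ c → evalLayer Mr x ≡ c → sensOn (evalLayer Mr) (vars Mr) x ≤ peak c [] (length Mr)
      by-value true  Mx = ≤-reflexive (layer-sens-true Mr Mx)
      by-value false Mx = layer-sens-false Mr u Mx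
  sens-upper (M ∷ Ms) Mr u k≥1 x with unique-++⁻ (vars M) u
  ... | uM , uR , disjoint = by-values (evalLayer M x) (nest Ms Mr x) refl refl
    where
      open AndNot (layer-depends M) (nest-depends Ms Mr) disjoint
      g = nest Ms Mr
      h = nest (M ∷ Ms) Mr
      W = support Ms Mr
      ks = sizes Ms
      k = length Mr

      split : ∀ {a b} → sensOn h (vars M) x ≡ a → sensOn h W x ≡ b → sensOn h (vars M ++ W) x ≡ a + b
      split left right = trans (sensOn-++ h (vars M) W x) (cong₂ _+_ left right)

      inner : ∀ {d} → g x ≡ d → sensOn g W x ≤ peak d ks k
      inner gx = subst (λ d → sensOn g W x ≤ peak d ks k) gx (sens-upper Ms Mr uR k≥1 x)

      by-values : ∀ c d → evalLayer M x ≡ c → g x ≡ d →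
                  sensOn h (vars M ++ W) x ≤ peak (c ∧ (d xor true)) (length M ∷ ks) k
      -- h x = 1: all of M plus the sensitive variables of g at a 0-point
      by-values true  false Mx gx = ≤-trans (≤-reflexive (split (trans (sens-V-free gx) (layer-sens-true M Mx)) (sens-W-free Mx)))
                                            (+-monoʳ-≤ (length M) (inner gx))
      -- g x = 1 blocks M: only the sensitive variables of g at a 1-point
      by-values true  true  Mx gx = ≤-trans (≤-reflexive (split (sens-V-blocked gx) (sens-W-free Mx))) (inner gx)
      -- M x = 0 blocks g: at most one variable of M
      by-values false false Mx gx =
        ≤-trans (≤-reflexive (trans (split (sens-V-free gx) (sens-W-blocked Mx)) (+-comm _ 0)))
                (≤-trans (layer-sens-false M uM Mx) (peak-pos true ks k≥1))
      by-values false true  Mx gx = ≤-trans (≤-reflexive (split (sens-V-blocked gx) (sens-W-blocked Mx))) z≤n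

  sens-lower : ∀ Ms Mr → Unique (support Ms Mr) → 1 ≤ length Mr → ∀ c →
               ∃[ x ] nest Ms Mr x ≡ c × peak c (sizes Ms) (length Mr) ≤ sensOn (nest Ms Mr) (support Ms Mr) x
  sens-lower [] [] _ () _
  sens-lower [] Mr@((j , a) ∷ _) u _ c = witness c
    where
      -- satisfy Mr, and for the value 0 flip its first variable back out
      y = satisfy Mr (λ _ → false)
      y-true = satisfy-true Mr _ u
      z-false = layer-flip Mr y-true (here refl)

      j-sensitive : Sensitive (evalLayer Mr) (flipAt j y) j
      j-sensitive e with () ← trans (sym (trans (layer-depends Mr (λ {i} _ → flipAt-involutive j y i)) y-true))
                                    (trans e z-false)

      witness : ∀ c → ∃[ x ] evalLayer Mr x ≡ c × peak c [] (length Mr) ≤ sensOn (evalLayer Mr) (vars Mr) x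
      witness true  = y , y-true , ≤-reflexive (sym (layer-sens-true Mr y-true))
      witness false = flipAt j y , z-false , filter-some (sensitive? (evalLayer Mr) (flipAt j y)) {vars Mr} (here j-sensitive)
  sens-lower (M ∷ Ms) Mr u k≥1 c with unique-++⁻ (vars M) u
  ... | uM , uR , disjoint = lift c (sens-lower Ms Mr uR k≥1 (not c))
    where
      open AndNot (layer-depends M) (nest-depends Ms Mr) disjoint
      g = nest Ms Mr
      h = nest (M ∷ Ms) Mr
      W = support Ms Mr
      ks = sizes Ms
      k = length Mr

      -- Satisfying M on top of x keeps g and its sensitivity, and makes h = ¬g.
      module Satisfied (x : Input n) where
        y = satisfy M x

        agree : Agree W y x
        agree i∈W = satisfy-outside M x (λ i∈M → disjoint i∈M i∈W)

        M-true : evalLayer M y ≡ true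
        M-true = satisfy-true M x uM

        g-same : g y ≡ g x
        g-same = nest-depends Ms Mr agree

        h-value : h y ≡ g x xor true
        h-value = trans (∧¬-u-true {u = evalLayer M} {g = g} M-true) (cong (_xor true) g-same)

        inner-sens : sensOn h W y ≡ sensOn g W x
        inner-sens = trans (sens-W-free M-true) (sensOn-agree W (nest-depends Ms Mr) agree)

      lift : ∀ c → ∃[ x ] g x ≡ not c × peak (not c) ks k ≤ sensOn g W x →
             ∃[ y ] h y ≡ c × peak c (length M ∷ ks) k ≤ sensOn h (vars M ++ W) y
      lift true (x , gx , bound) = y , trans h-value (cong (_xor true) gx) , (begin
        length M + peak false ks k           ≤⟨ +-monoʳ-≤ (length M) bound ⟩
        length M + sensOn g W x              ≡⟨ cong₂ _+_ (trans (sens-V-free (trans g-same gx)) (layer-sens-true M M-true))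
                                                          inner-sens ⟨
        sensOn h (vars M) y + sensOn h W y   ≡⟨ sensOn-++ h (vars M) W y ⟨
        sensOn h (vars M ++ W) y             ∎)
        where open Satisfied x
              open ≤-Reasoning
      lift false (x , gx , bound) = y , trans h-value (cong (_xor true) gx) , (begin
        peak true ks k                       ≤⟨ bound ⟩
        sensOn g W x                         ≡⟨ inner-sens ⟨
        sensOn h W y                         ≤⟨ m≤n+m _ (sensOn h (vars M) y) ⟩
        sensOn h (vars M) y + sensOn h W y   ≡⟨ sensOn-++ h (vars M) W y ⟨
        sensOn h (vars M ++ W) y             ∎)
        where open Satisfied x
              open ≤-Reasoning

module Layered {n r : ℕ} {f : BoolFun n} (H : HasLayerNumber n f r) where
  open HasLayerNumber H using (Ms; Mr; b; repr; krGe2; nLayers)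

  private
    g = nest Ms Mr
    V = support Ms Mr
    ks = sizes Ms
    k = length Mr

  support-↭ : V ↭ allFin n
  support-↭ = subst (_↭ allFin n) (sym (support-concat Ms Mr)) (HasLayerNumber.vars H)

  support-unique : Unique V
  support-unique = Unique-resp-↭ (setoid (Fin n)) (↭⇒↭ₛ (↭-sym support-↭)) (allFin⁺ n)

  variable-count : sum ks + k ≡ n
  variable-count = trans (sym (length-support Ms Mr)) (trans (↭-length support-↭) (length-tabulate (λ i → i)))

  layer-count : suc (length ks) ≡ r
  layer-count = trans (cong suc (length-map length Ms)) nLayers

  -- f = g ⊕ b, and the variables of f are exactly those of g.
  sensAt-nest : ∀ x → sensAt f x ≡ sensOn g V x
  sensAt-nest x = begin
    sensOn f (allFin n) x                   ≡⟨ sensOn-cong {h = f} {u = λ y → g y xor b} (allFin n) (λ {i} _ → repr (flipAt i x)) (repr x) ⟩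
    sensOn (λ y → g y xor b) (allFin n) x   ≡⟨ sensOn-xor g b (allFin n) x ⟩
    sensOn g (allFin n) x                   ≡⟨ sensOn-↭ g x (↭-sym support-↭) ⟩
    sensOn g V x                            ∎
    where open ≡-Reasoning

  sensitivity-peaks : sensitivity f ≡ peak false ks k ⊔ peak true ks k
  sensitivity-peaks = ≤-antisym (maxOf-lub (sensAt f) (allInputs n) bounded) (⊔-lub (attained false) (attained true))
    where
      open ≤-Reasoning

      bounded : ∀ {x} → x ∈ allInputs n → sensAt f x ≤ peak false ks k ⊔ peak true ks k
      bounded {x} _ = begin
        sensAt f x                        ≡⟨ sensAt-nest x ⟩
        sensOn g V x                      ≤⟨ sens-upper Ms Mr support-unique (<⇒≤ krGe2) x ⟩
        peak (g x) ks k                   ≤⟨ peak-≤-⊔ (g x) ks k ⟩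
        peak false ks k ⊔ peak true ks k  ∎

      attained : ∀ c → peak c ks k ≤ sensitivity f
      attained c with sens-lower Ms Mr support-unique (<⇒≤ krGe2) c
      ... | x , _ , bound with allInputs-complete n x
      ... | y , y∈ , y≗x = begin
        peak c ks k       ≤⟨ bound ⟩
        sensOn g V x      ≡⟨ sensOn-agree V (nest-depends Ms Mr) (λ {i} _ → sym (y≗x i)) ⟩
        sensOn g V y      ≡⟨ sensAt-nest y ⟨
        sensAt f y        ≤⟨ maxOf-upper (sensAt f) y∈ ⟩
        sensitivity f     ∎

CorollaryBounds : ℕ → ℕ → ℕ → Set
CorollaryBounds n s r =
  (r ≡ 1 → s ≡ n)
  × (r + 1 ≡ n → (2 ∣ n → 2 * s ≡ n + 2) × (¬ (2 ∣ n) → 2 * s ≡ n + 1))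
  × (2 ≤ r → r + 2 ≤ n →
       (n + 1 ≤ 2 * s) × (¬ (2 ∣ r) → 2 * s + r ≤ 2 * n + 1) × (2 ∣ r → 2 * s + r ≤ 2 * n + 2))

CorollaryBounds-subst : ∀ {n n′ s s′ r r′} → n ≡ n′ → s ≡ s′ → r ≡ r′ →
                        CorollaryBounds n s r → CorollaryBounds n′ s′ r′
CorollaryBounds-subst refl refl refl bounds = bounds

≤-complement : ∀ {a b c l} → a + b ≡ c → l ≤ b → a + l ≤ c
≤-complement {a} a+b≡c l≤b = ≤-trans (+-monoʳ-≤ a l≤b) (≤-reflexive a+b≡c)

2∤1 : ¬ (2 ∣ 1)
2∤1 2∣1 with () ← ∣1⇒≡1 2∣1

even-squeeze : ∀ {n m} → n + 1 ≤ m → m ≤ n + 2 → 2 ∣ m →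
               (2 ∣ n → m ≡ n + 2) × (¬ (2 ∣ n) → m ≡ n + 1)
even-squeeze {n} {m} lo hi 2∣m = (λ 2∣n → ≤-antisym hi (above 2∣n)) , (λ 2∤n → ≤-antisym (below 2∤n) lo)
  where
    above : 2 ∣ n → n + 2 ≤ m
    above 2∣n = subst (_≤ m) (sym (+-suc n 1))
      (≤∧≢⇒< lo (λ n+1≡m → 2∤1 (∣m+n∣m⇒∣n (subst (2 ∣_) (sym n+1≡m) 2∣m) 2∣n)))
    below : ¬ (2 ∣ n) → m ≤ n + 1
    below 2∤n = ≤-pred (subst (m <_) (+-suc n 1)
      (≤∧≢⇒< hi (λ m≡n+2 → 2∤n (∣m+n∣m⇒∣n (subst (2 ∣_) (trans m≡n+2 (+-comm n 2)) 2∣m) (∣-refl {2})))))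

-- Two ways of writing 2(n + 1), used to cancel n + 1 resp. n in s-tight.
double-suc₁ : ∀ n → 2 + 2 * n ≡ (n + 1) + (n + 1)
double-suc₁ = solve-∀

double-suc₂ : ∀ n → 2 + 2 * n ≡ (n + 2) + n
double-suc₂ = solve-∀

module PeakArithmetic {n r p₀ p₁ : ℕ} (total : p₀ + p₁ ≡ suc n) (lo₀ : suc r ≤ 2 * p₀) (lo₁ : 2 + r ≤ 2 * p₁) where
  open ≤-Reasoning

  s : ℕ
  s = p₀ ⊔ p₁

  -- Doubling p₀ + p₁ = n + 1; a lower bound on one doubled peak bounds the other from above.
  doubled : 2 * p₀ + 2 * p₁ ≡ 2 + 2 * n
  doubled = trans (sym (*-distribˡ-+ 2 p₀ p₁)) (trans (cong (2 *_) total) (*-suc 2 n))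

  hi₀ : 2 * p₀ + (2 + r) ≤ 2 + 2 * n
  hi₀ = ≤-complement doubled lo₁

  hi₁ : 2 * p₁ + suc r ≤ 2 + 2 * n
  hi₁ = ≤-complement (trans (+-comm (2 * p₁) (2 * p₀)) doubled) lo₀

  -- 2s ≥ p₀ + p₁ = n + 1.
  s-lower : n + 1 ≤ 2 * s
  s-lower = begin
    n + 1                       ≡⟨ trans (+-comm n 1) (sym total) ⟩
    p₀ + p₁                     ≤⟨ +-mono-≤ (m≤m⊔n p₀ p₁) (m≤n⊔m p₀ p₁) ⟩
    s + s                       ≡⟨ cong (s +_) (+-identityʳ s) ⟨
    2 * s               ∎

  -- 2s + r ≤ 2n + 1 holds for either parity of r.
  s-upper : 2 * s + r ≤ 2 * n + 1
  s-upper = begin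
    2 * s + r                   ≡⟨ cong (_+ r) (*-distribˡ-⊔ 2 p₀ p₁) ⟩
    (2 * p₀ ⊔ 2 * p₁) + r       ≡⟨ +-distribʳ-⊔ r (2 * p₀) (2 * p₁) ⟩
    (2 * p₀ + r) ⊔ (2 * p₁ + r) ≤⟨ ⊔-lub from-p₀ from-p₁ ⟩
    2 * n + 1                   ∎
    where
      from-p₀ : 2 * p₀ + r ≤ 2 * n + 1
      from-p₀ = ≤-trans (≤-pred (≤-pred (≤-trans (≤-reflexive (sym (trans (+-suc _ _) (cong suc (+-suc _ _))))) hi₀)))
                        (m≤m+n (2 * n) 1)
      from-p₁ : 2 * p₁ + r ≤ 2 * n + 1
      from-p₁ = ≤-pred (≤-trans (≤-reflexive (sym (+-suc (2 * p₁) r)))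
                                (≤-trans hi₁ (≤-reflexive (cong suc (+-comm 1 (2 * n))))))

  -- With r = n - 1 the lower bounds leave no room: 2p₀ ≤ n + 1 ≤ 2p₁ ≤ n + 2.
  s-tight : r + 1 ≡ n → (2 ∣ n → 2 * s ≡ n + 2) × (¬ (2 ∣ n) → 2 * s ≡ n + 1)
  s-tight r+1≡n = subst (λ t → (2 ∣ n → 2 * t ≡ n + 2) × (¬ (2 ∣ n) → 2 * t ≡ n + 1))
                        (sym (m≤n⇒m⊔n≡n p₀≤p₁)) (even-squeeze n+1≤2p₁ 2p₁≤n+2 (m∣m*n p₁))
    where
      1+r≡n : suc r ≡ n
      1+r≡n = trans (+-comm 1 r) r+1≡n
      2+r≡n+1 : 2 + r ≡ n + 1
      2+r≡n+1 = trans (cong suc 1+r≡n) (+-comm 1 n)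
      n+1≤2p₁ : n + 1 ≤ 2 * p₁
      n+1≤2p₁ = subst (_≤ 2 * p₁) 2+r≡n+1 lo₁
      2p₀≤n+1 : 2 * p₀ ≤ n + 1
      2p₀≤n+1 = +-cancelʳ-≤ (n + 1) (2 * p₀) (n + 1)
                  (subst₂ _≤_ (cong (2 * p₀ +_) 2+r≡n+1) (double-suc₁ n) hi₀)
      2p₁≤n+2 : 2 * p₁ ≤ n + 2
      2p₁≤n+2 = +-cancelʳ-≤ n (2 * p₁) (n + 2)
                  (subst₂ _≤_ (cong (2 * p₁ +_) 1+r≡n) (double-suc₂ n) hi₁)
      p₀≤p₁ : p₀ ≤ p₁
      p₀≤p₁ = *-cancelˡ-≤ 2 (≤-trans 2p₀≤n+1 n+1≤2p₁)

peak-bounds : ∀ ks k → All (1 ≤_) ks → 2 ≤ k →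
              CorollaryBounds (sum ks + k) (peak false ks k ⊔ peak true ks k) (suc (length ks))
peak-bounds ks k ks≥1 k≥2 =
  single-layer ks , s-tight , λ _ _ → s-lower , (λ _ → s-upper) , (λ _ → ≤-trans s-upper (+-monoʳ-≤ (2 * (sum ks + k)) (n≤1+n 1)))
  where
    open PeakArithmetic {p₀ = peak false ks k} {p₁ = peak true ks k} (peak-sum ks k) (proj₁ (peak-lower ks ks≥1 k≥2)) (proj₂ (peak-lower ks ks≥1 k≥2))

    single-layer : ∀ ms → suc (length ms) ≡ 1 → peak false ms k ⊔ peak true ms k ≡ sum ms + k
    single-layer []      _  = m≤n⇒m⊔n≡n (<⇒≤ k≥2)
    single-layer (_ ∷ _) ()

corollary3p1 : (n : ℕ) → 2 ≤ n → (f : BoolFun n) → IsNCF n f →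
    (r : ℕ) → HasLayerNumber n f r →
      (r ≡ 1 → sensitivity f ≡ n)
      × (r + 1 ≡ n → (2 ∣ n → 2 * sensitivity f ≡ n + 2)
                   × (¬ (2 ∣ n) → 2 * sensitivity f ≡ n + 1))
      × (2 ≤ r → r + 2 ≤ n →
           (n + 1 ≤ 2 * sensitivity f)
           × (¬ (2 ∣ r) → 2 * sensitivity f + r ≤ 2 * n + 1)
           × (2 ∣ r → 2 * sensitivity f + r ≤ 2 * n + 2))
corollary3p1 n _ f _ r H =
  CorollaryBounds-subst variable-count (sym sensitivity-peaks) layer-count
    (peak-bounds (sizes Ms) (length Mr) (All.map⁺ kPos) krGe2)
  where
    open HasLayerNumber H using (Ms; Mr; kPos; krGe2)
    open Layered H using (variable-count; layer-count; sensitivity-peaks)
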